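{- Let $n,k$ be integers with $2\le 2k\le n-4$, and let $\lambda\in\overline{\mathcal{U}}_{T_{n,n-2k}}$ with largest part $2n-5$. Let $Y_{S_\lambda}$ be its Keith--Nath Young diagram with hook lengths $h_{i,j}$. Then for every $1\le i\le n-2$, $h_{i,1}=h_{1,i}$.
   Context: Partitions into distinct parts: $\lambda=(\lambda_1<\dots<\lambda_t)$, $t\ge2$. Missing parts $\mathcal{M}_\lambda=\{1,\dots,\lambda_t\}\setminus\{\lambda_i\}$. Unrefinable: no two distinct missing parts sum to a part. Maximal: largest part is maximum among unrefinable partitions of the same integer. $\overline{\mathcal{U}}_N$: maximal unrefinable partitions of $N$ with $\#\mathcal{M}_\lambda=\lfloor\lambda_t/2\rfloor$. $T_n=n(n+1)/2$, $T_{n,d}=T_n-d$. $S_\lambda=\mathbb{N}_0\setminus\lambda$; $Y_{S_\lambda}$ (English convention) has one row per part $g$ of $\lambda$, ordered top to bottom by decreasing $g$, the row of $g$ having $\#\{s\in S_\lambda:s<g\}$ cells. $h_{i,j}$ is the hook length (arm + leg + 1) of the cell in row $i$, column $j$. -}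

module Defs where

open import Data.Nat using (ℕ; zero; suc; _+_; _*_; _∸_; _≤_; _<_; _⊔_; _≤?_)
open import Data.Nat.Properties using (_≟_)
open import Data.Nat.DivMod using (_/_)
open import Data.List using (List; []; _∷_; length; filter; reverse; drop; map; foldr; upTo)
open import Data.Nat.ListAction using (sum)
open import Data.List.Membership.DecPropositional _≟_ using (_∈_; _∉_; _∈?_)
open import Data.List.Relation.Unary.Linked using (Linked)
open import Data.List.Relation.Unary.All using (All)
open import Data.Product using (_×_)
open import Relation.Binary.PropositionalEquality using (_≡_; _≢_)
open import Relation.Nullary using (¬_)

IsDistinctPartition : List ℕ → Set
IsDistinctPartition λ′ = Linked _<_ λ′ × All (λ x → 1 ≤ x) λ′ × 2 ≤ length λ′

largest : List ℕ → ℕ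
largest = foldr _⊔_ 0

oneTo : ℕ → List ℕ
oneTo m = map suc (upTo m)

missing : List ℕ → List ℕ
missing λ′ = filter (λ x → ¬? (x ∈? λ′)) (oneTo (largest λ′))
  where open import Relation.Nullary.Decidable using (¬?)

Unrefinable : List ℕ → Set
Unrefinable λ′ = ∀ a b → a ∈ missing λ′ → b ∈ missing λ′ → a ≢ b → (a + b) ∉ λ′

UnrefinablePartitionOf : ℕ → List ℕ → Set
UnrefinablePartitionOf N λ′ = IsDistinctPartition λ′ × sum λ′ ≡ N × Unrefinable λ′

MaximalUnrefinable : ℕ → List ℕ → Set
MaximalUnrefinable N λ′ =
  UnrefinablePartitionOf N λ′ ×
  (∀ μ → UnrefinablePartitionOf N μ → largest μ ≤ largest λ′)

UBar : ℕ → List ℕ → Set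
UBar N λ′ = MaximalUnrefinable N λ′ × length (missing λ′) ≡ largest λ′ / 2

T : ℕ → ℕ
T n = (n * suc n) / 2

T₂ : ℕ → ℕ → ℕ
T₂ n d = T n ∸ d

-- row of Y_{S_λ} for a part g: #{ s ∈ S_λ : s < g }, S_λ = ℕ₀ \ λ
rowLength : List ℕ → ℕ → ℕ
rowLength λ′ g = length (filter (λ s → ¬? (s ∈? λ′)) (upTo g))
  where open import Relation.Nullary.Decidable using (¬?)

rows : List ℕ → List ℕ
rows λ′ = map (rowLength λ′) (reverse λ′)

-- 1-based lookup with default 0
at : List ℕ → ℕ → ℕ
at []       _             = 0
at (x ∷ xs) zero          = 0
at (x ∷ xs) (suc zero)    = x
at (x ∷ xs) (suc (suc i)) = at xs (suc i)

numRows : List ℕ → ℕ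
numRows λ′ = length (rows λ′)

IsCell : List ℕ → ℕ → ℕ → Set
IsCell λ′ i j = 1 ≤ i × i ≤ numRows λ′ × 1 ≤ j × j ≤ at (rows λ′) i

-- hook length h_{i,j} = arm + leg + 1 (1-based indices)
hook : List ℕ → ℕ → ℕ → ℕ
hook λ′ i j = (at (rows λ′) i ∸ j)
            + length (filter (λ r → j ≤? r) (drop i (rows λ′)))
            + 1

{-# OPTIONS --safe #-}
module Submission where

-- Let L = 2m + 1 be the largest part.  Together with 0, the m missing parts give m + 1 gaps of λ
-- in [0, L], hence also m + 1 parts there.  Unrefinability puts a part in every pair {x, L − x}
-- (L itself is a part), and as there are as many pairs as parts, each pair holds exactly one:
-- x is a part iff L − x is a gap.  In any Keith–Nath diagram the first-column hook in the row
-- of a part g equals g, and the first-row hook in the column of a gap s < L equals L − s.  The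
-- reflection sends the i-th largest part g to the i-th smallest gap L − g, so
-- h_{i,1} = g = L − (L − g) = h_{1,i}.

open import Defs
open import Data.Nat.Properties
open import Algebra.Properties.CommutativeSemigroup +-commutativeSemigroup using (interchange)
open import Data.Bool using (if_then_else_)
open import Data.Empty using (⊥-elim)
open import Data.List using (List; []; _∷_; [_]; _++_; _∷ʳ_; length; filter; reverse; drop; map; upTo; downFrom; applyUpTo)
open import Data.List.Membership.DecPropositional _≟_ using (_∈?_)
open import Data.List.Membership.Propositional using (_∈_; _∉_)
open import Data.List.Membership.Propositional.Properties using (∈-filter⁺; ∈-filter⁻; ∈-upTo⁺; ∈-downFrom⁻; ∈-map⁺)
open import Data.List.Properties using (filter-++; filter-accept; filter-none; filter-all; filter-≐; unfold-reverse; ++-identityʳ; length-reverse; length-map; length-drop; reverse-upTo; map-upTo; map-cong; drop-map; foldr-preservesᵒ)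
open import Data.List.Relation.Unary.All using (All; [])
import Data.List.Relation.Unary.All as All
import Data.List.Relation.Unary.All.Properties as All
open import Data.List.Relation.Unary.Any using (here; there)
import Data.List.Relation.Unary.Any as Any
import Data.List.Relation.Unary.Any.Properties as Any
open import Data.List.Relation.Unary.Linked using (Linked; [-]; _∷_; tail)
open import Data.List.Relation.Unary.Linked.Properties using (Linked⇒All; filter⁺; applyUpTo⁺₂)
open import Data.Nat using (ℕ; zero; suc; _+_; _*_; _∸_; _/_; _≤_; _<_; z≤n; s≤s; z<s; _≤′_; ≤′-refl; ≤′-step)
open import Data.Nat.Divisibility using (divides-refl)
open import Data.Nat.DivMod using (+-distrib-/-∣ʳ; m*n/n≡m)
open import Data.Product using (_×_; _,_; proj₁; proj₂)
open import Data.Sum using (_⊎_; inj₁; inj₂; [_,_]′)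
open import Function using (_∘′_; id; const)
open import Level using (0ℓ)
open import Relation.Binary.PropositionalEquality using (_≡_; _≢_; refl; sym; trans; subst; cong; cong₂; module ≡-Reasoning)
open import Relation.Nullary using (¬_; yes; no; does; contradiction)
open import Relation.Unary using (Pred; Decidable; ∁; _≐_)
open import Relation.Unary.Properties using (∁?; _∩?_)

count : {P : Pred ℕ 0ℓ} → Decidable P → ℕ → ℕ
count P? zero    = 0
count P? (suc t) = (if does (P? t) then 1 else 0) + count P? t

module _ {P : Pred ℕ 0ℓ} (P? : Decidable P) where

  count-mono : ∀ {m n} → m ≤ n → count P? m ≤ count P? n
  count-mono = mono′ ∘′ ≤⇒≤′
    where
    mono′ : ∀ {m n} → m ≤′ n → count P? m ≤ count P? n
    mono′ ≤′-refl       = ≤-refl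
    mono′ (≤′-step m≤n) = ≤-trans (mono′ m≤n) (m≤n+m _ _)

  count-complement : ∀ t → count P? t + count (∁? P?) t ≡ t
  count-complement zero = refl
  count-complement (suc t) with P? t
  ... | yes _ = cong suc (count-complement t)
  ... | no  _ = trans (+-suc _ _) (cong suc (count-complement t))

  count-cong : ∀ {Q : Pred ℕ 0ℓ} (Q? : Decidable Q) t →
               (∀ x → x < t → (P x → Q x) × (Q x → P x)) → count P? t ≡ count Q? t
  count-cong Q? zero    P⇔Q = refl
  count-cong Q? (suc t) P⇔Q
    with P? t | Q? t | P⇔Q t ≤-refl | count-cong Q? t (λ x x<t → P⇔Q x (m<n⇒m<1+n x<t))
  ... | yes _ | yes _ | _       | ih = cong suc ih
  ... | no  _ | no  _ | _       | ih = ih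
  ... | yes p | no ¬q | (f , _) | _  = ⊥-elim (¬q (f p))
  ... | no ¬p | yes q | (_ , g) | _  = ⊥-elim (¬p (g q))

  count-suc-accept : ∀ {t} → P t → count P? (suc t) ≡ suc (count P? t)
  count-suc-accept {t} Pt with P? t
  ... | yes _ = refl
  ... | no ¬Pt = ⊥-elim (¬Pt Pt)

  count-suc-reject : ∀ {t} → ¬ P t → count P? (suc t) ≡ count P? t
  count-suc-reject {t} ¬Pt with P? t
  ... | yes Pt = ⊥-elim (¬Pt Pt)
  ... | no  _  = refl

  count-threshold : ∀ {s p} → P s → count P? (suc s) ≤ count P? p → suc s ≤ p
  count-threshold {s} {p} Ps c≤c with suc s ≤? p
  ... | yes s<p = s<p
  ... | no  s≮p = contradiction c≤c (<⇒≱ (begin-strict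
        count P? p        ≤⟨ count-mono (≤-pred (≰⇒> s≮p)) ⟩
        count P? s        <⟨ n<1+n _ ⟩
        suc (count P? s)  ≡⟨ count-suc-accept Ps ⟨
        count P? (suc s)  ∎))
    where open ≤-Reasoning

  count-reflect : ∀ L a → a ≤ suc L →
                  count (λ x → P? (L ∸ x)) a + count P? (suc L ∸ a) ≡ count P? (suc L)
  count-reflect L zero    _         = refl
  count-reflect L (suc a) (s≤s a≤L) = begin
    (b + r) + count P? (L ∸ a)    ≡⟨ cong (_+ count P? (L ∸ a)) (+-comm b r) ⟩
    (r + b) + count P? (L ∸ a)    ≡⟨ +-assoc r b _ ⟩
    r + count P? (suc (L ∸ a))    ≡⟨ cong (λ y → r + count P? y) (+-∸-assoc 1 a≤L) ⟨
    r + count P? (suc L ∸ a)      ≡⟨ count-reflect L a (m≤n⇒m≤1+n a≤L) ⟩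
    count P? (suc L)              ∎
    where
    open ≡-Reasoning
    b = if does (P? (L ∸ a)) then 1 else 0
    r = count (λ x → P? (L ∸ x)) a

  count≡0⇒¬ : ∀ {t x} → count P? t ≡ 0 → x < t → ¬ P x
  count≡0⇒¬ {suc t} {x} c≡0 x<1+t with P? t | m<1+n⇒m<n∨m≡n x<1+t
  ... | no _  | inj₁ x<t = count≡0⇒¬ c≡0 x<t
  ... | no ¬p | inj₂ refl = ¬p

  module _ {Q : Pred ℕ 0ℓ} (Q? : Decidable Q) where

    count-inclusion-exclusion : ∀ t → (∀ x → x < t → P x ⊎ Q x) →
                                count P? t + count Q? t ≡ t + count (P? ∩? Q?) t
    count-inclusion-exclusion zero    _     = refl
    count-inclusion-exclusion (suc t) cover
      with P? t | Q? t | cover t ≤-refl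
         | count-inclusion-exclusion t (λ x x<t → cover x (m<n⇒m<1+n x<t))
    ... | yes _ | yes _ | _      | ih = cong suc (trans (+-suc _ _) (trans (cong suc ih) (sym (+-suc t _))))
    ... | yes _ | no  _ | _      | ih = cong suc ih
    ... | no  _ | yes _ | _      | ih = trans (+-suc _ _) (cong suc ih)
    ... | no ¬p | no  _ | inj₁ p | _  = ⊥-elim (¬p p)
    ... | no  _ | no ¬q | inj₂ q | _  = ⊥-elim (¬q q)

module _ {P : Pred ℕ 0ℓ} (P? : Decidable P) (L : ℕ) where

  reflection-matching : (∀ x → x ≤ L → P x ⊎ P (L ∸ x)) → 2 * count P? (suc L) ≡ suc L →
                        ∀ {x} → x ≤ L → P x → ¬ P (L ∸ x)
  reflection-matching cover half x≤L Px PLx =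
    count≡0⇒¬ (P? ∩? reflected?) no-overlap (s≤s x≤L) (Px , PLx)
    where
    open ≡-Reasoning
    reflected? : Decidable (λ x → P (L ∸ x))
    reflected? x = P? (L ∸ x)
    c = count P? (suc L)
    reflected-count : count reflected? (suc L) ≡ c
    reflected-count = begin
      count reflected? (suc L)                            ≡⟨ +-identityʳ _ ⟨
      count reflected? (suc L) + count P? 0               ≡⟨ cong (λ y → count reflected? (suc L) + count P? y) (n∸n≡0 L) ⟨
      count reflected? (suc L) + count P? (suc L ∸ suc L) ≡⟨ count-reflect P? L (suc L) ≤-refl ⟩
      c                                                   ∎
    cover′ : ∀ x → x < suc L → P x ⊎ P (L ∸ x)
    cover′ x x<1+L = cover x (≤-pred x<1+L)
    no-overlap : count (P? ∩? reflected?) (suc L) ≡ 0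
    no-overlap = +-cancelˡ-≡ (suc L) _ 0 (begin
      suc L + count (P? ∩? reflected?) (suc L)  ≡⟨ count-inclusion-exclusion P? reflected? (suc L) cover′ ⟨
      c + count reflected? (suc L)              ≡⟨ cong (c +_) (trans reflected-count (sym (+-identityʳ c))) ⟩
      2 * c                                     ≡⟨ half ⟩
      suc L                                     ≡⟨ +-identityʳ _ ⟨
      suc L + 0                                 ∎)

filter-reverse : ∀ {A : Set} {P : Pred A 0ℓ} (P? : Decidable P) xs →
                 reverse (filter P? xs) ≡ filter P? (reverse xs)
filter-reverse P? []       = refl
filter-reverse P? (x ∷ xs) = begin
  reverse (filter P? (x ∷ xs))                ≡⟨ last-step ⟩
  filter P? (reverse xs) ++ filter P? [ x ]   ≡⟨ filter-++ P? (reverse xs) [ x ] ⟨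
  filter P? (reverse xs ∷ʳ x)                 ≡⟨ cong (filter P?) (unfold-reverse x xs) ⟨
  filter P? (reverse (x ∷ xs))                ∎
  where
  open ≡-Reasoning
  last-step : reverse (filter P? (x ∷ xs)) ≡ filter P? (reverse xs) ++ filter P? [ x ]
  last-step with P? x
  ... | yes _ = trans (unfold-reverse x (filter P? xs)) (cong (_∷ʳ x) (filter-reverse P? xs))
  ... | no  _ = trans (filter-reverse P? xs) (sym (++-identityʳ _))

filter-map : ∀ {A B : Set} {Q : Pred B 0ℓ} (Q? : Decidable Q) (f : A → B) xs →
             filter Q? (map f xs) ≡ map f (filter (λ x → Q? (f x)) xs)
filter-map Q? f []       = refl
filter-map Q? f (x ∷ xs) with Q? (f x)
... | yes _ = cong (f x ∷_) (filter-map Q? f xs)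
... | no  _ = filter-map Q? f xs

module _ {P : Pred ℕ 0ℓ} (P? : Decidable P) where

  length-filter-downFrom : ∀ t → length (filter P? (downFrom t)) ≡ count P? t
  length-filter-downFrom zero = refl
  length-filter-downFrom (suc t) with P? t
  ... | yes _ = cong suc (length-filter-downFrom t)
  ... | no  _ = length-filter-downFrom t

  length-filter-upTo : ∀ t → length (filter P? (upTo t)) ≡ count P? t
  length-filter-upTo t = begin
    length (filter P? (upTo t))             ≡⟨ length-reverse (filter P? (upTo t)) ⟨
    length (reverse (filter P? (upTo t)))   ≡⟨ cong length (filter-reverse P? (upTo t)) ⟩
    length (filter P? (reverse (upTo t)))   ≡⟨ cong (length ∘′ filter P?) (reverse-upTo t) ⟩
    length (filter P? (downFrom t))         ≡⟨ length-filter-downFrom t ⟩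
    count P? t                              ∎
    where open ≡-Reasoning

  length-filter-≤-downFrom : ∀ {t N} → t ≤ N →
    length (filter (t ≤?_) (filter P? (downFrom N))) + count P? t ≡ count P? N
  length-filter-≤-downFrom = from-bottom ∘′ ≤⇒≤′
    where
    from-bottom : ∀ {t N} → t ≤′ N →
      length (filter (t ≤?_) (filter P? (downFrom N))) + count P? t ≡ count P? N
    from-bottom {t} ≤′-refl = cong (λ xs → length xs + count P? t)
      (filter-none (t ≤?_) (All.tabulate (λ p∈ → <⇒≱ (∈-downFrom⁻ (proj₁ (∈-filter⁻ P? p∈))))))
    from-bottom {t} {suc N} (≤′-step t≤′N) with P? N
    ... | yes _ = trans (cong (λ xs → length xs + count P? t) (filter-accept (t ≤?_) (≤′⇒≤ t≤′N)))
                        (cong suc (from-bottom t≤′N))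
    ... | no  _ = from-bottom t≤′N

  drop-filter-downFrom : ∀ N i → suc i ≤ length (filter P? (downFrom N)) →
    drop (suc i) (filter P? (downFrom N)) ≡ filter P? (downFrom (at (filter P? (downFrom N)) (suc i)))
  drop-filter-downFrom (suc N) i i<len with P? N
  drop-filter-downFrom (suc N) zero    _           | yes _ = refl
  drop-filter-downFrom (suc N) (suc i) (s≤s i<len) | yes _ = drop-filter-downFrom N i i<len
  drop-filter-downFrom (suc N) i       i<len       | no  _ = drop-filter-downFrom N i i<len

at-map : ∀ (f : ℕ → ℕ) xs i → suc i ≤ length xs → at (map f xs) (suc i) ≡ f (at xs (suc i))
at-map f (x ∷ xs) zero    _           = refl
at-map f (x ∷ xs) (suc i) (s≤s i<len) = at-map f xs i i<len

at-∈ : ∀ xs i → suc i ≤ length xs → at xs (suc i) ∈ xs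
at-∈ (x ∷ xs) zero    _           = here refl
at-∈ (x ∷ xs) (suc i) (s≤s i<len) = there (at-∈ xs i i<len)

head<tail : ∀ {x xs} → Linked _<_ (x ∷ xs) → All (x <_) xs
head<tail [-]     = []
head<tail (x<y ∷ l) = Linked⇒All <-trans x<y l

strictlyIncreasing-unique : ∀ {xs ys} → Linked _<_ xs → Linked _<_ ys →
  (∀ {z} → z ∈ xs → z ∈ ys) → (∀ {z} → z ∈ ys → z ∈ xs) → xs ≡ ys
strictlyIncreasing-unique {[]}     {[]}     _ _ _ _ = refl
strictlyIncreasing-unique {[]}     {y ∷ ys} _ _ _ ys⊆ with () ← ys⊆ (here refl)
strictlyIncreasing-unique {x ∷ xs} {[]}     _ _ xs⊆ _ with () ← xs⊆ (here refl)
strictlyIncreasing-unique {x ∷ xs} {y ∷ ys} ↗xs ↗ys xs⊆ ys⊆ =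
  cong₂ _∷_ x≡y (strictlyIncreasing-unique (tail ↗xs) (tail ↗ys) xs⊆′ ys⊆′)
  where
  x≡y : x ≡ y
  x≡y with xs⊆ (here refl) | ys⊆ (here refl)
  ... | here x≡y | _         = x≡y
  ... | there _  | here y≡x  = sym y≡x
  ... | there x∈ | there y∈  = ⊥-elim (<-asym (All.lookup (head<tail ↗ys) x∈) (All.lookup (head<tail ↗xs) y∈))
  xs⊆′ : ∀ {z} → z ∈ xs → z ∈ ys
  xs⊆′ z∈ with xs⊆ (there z∈)
  ... | here refl = ⊥-elim (<-irrefl x≡y (All.lookup (head<tail ↗xs) z∈))
  ... | there z∈′ = z∈′
  ys⊆′ : ∀ {z} → z ∈ ys → z ∈ xs
  ys⊆′ z∈ with ys⊆ (there z∈)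
  ... | here refl = ⊥-elim (<-irrefl (sym x≡y) (All.lookup (head<tail ↗ys) z∈))
  ... | there z∈′ = z∈′

strictlyIncreasing≡filter-upTo : ∀ {xs N} → Linked _<_ xs → All (_< N) xs → xs ≡ filter (_∈? xs) (upTo N)
strictlyIncreasing≡filter-upTo {xs} {N} ↗xs xs<N = strictlyIncreasing-unique ↗xs
  (filter⁺ (_∈? xs) <-trans {upTo N} (applyUpTo⁺₂ id N (λ _ → n<1+n _)))
  (λ z∈ → ∈-filter⁺ (_∈? xs) (∈-upTo⁺ (All.lookup xs<N z∈)) z∈)
  (λ z∈ → proj₂ (∈-filter⁻ (_∈? xs) {xs = upTo N} z∈))

largest-∈ : ∀ xs → 0 < largest xs → largest xs ∈ xs
largest-∈ (x ∷ xs) 0<max with ⊔-sel x (largest xs)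
... | inj₁ eq = here eq
... | inj₂ eq = there (subst (_∈ xs) (sym eq) (largest-∈ xs (subst (0 <_) eq 0<max)))

∈⇒≤-largest : ∀ {z xs} → z ∈ xs → z ≤ largest xs
∈⇒≤-largest z∈ =
  foldr-preservesᵒ (λ x y → [ m≤n⇒m≤n⊔o y , m≤n⇒m≤o⊔n x ]′) 0 _ (inj₂ (Any.map ≤-reflexive z∈))

module Diagram (λ′ : List ℕ) (L : ℕ) (increasing : Linked _<_ λ′) (positive : All (1 ≤_) λ′)
                  (bounded : All (_≤ L) λ′) (L∈λ : L ∈ λ′) where

  part? : Decidable (_∈ λ′)
  part? = _∈? λ′

  gap? : Decidable (∁ (_∈ λ′))
  gap? = ∁? part?

  partsBelow : ℕ → List ℕ
  partsBelow N = filter part? (downFrom N)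

  0∉λ : 0 ∉ λ′
  0∉λ 0∈λ with () ← All.lookup positive 0∈λ

  gaps-below-part : ∀ {p} → p ∈ λ′ → 1 ≤ count gap? p
  gaps-below-part {p} p∈λ =
    subst (_≤ count gap? p) (count-suc-accept gap? 0∉λ) (count-mono gap? (All.lookup positive p∈λ))

  reverse-λ≡partsBelow : reverse λ′ ≡ partsBelow (suc L)
  reverse-λ≡partsBelow = begin
    reverse λ′                             ≡⟨ cong reverse (strictlyIncreasing≡filter-upTo increasing (All.map s≤s bounded)) ⟩
    reverse (filter part? (upTo (suc L)))  ≡⟨ filter-reverse part? (upTo (suc L)) ⟩
    filter part? (reverse (upTo (suc L)))  ≡⟨ cong (filter part?) (reverse-upTo (suc L)) ⟩
    partsBelow (suc L)                     ∎
    where open ≡-Reasoning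

  rows≡ : rows λ′ ≡ map (count gap?) (partsBelow (suc L))
  rows≡ = trans (cong (map (rowLength λ′)) reverse-λ≡partsBelow) (map-cong (length-filter-upTo gap?) _)

  rows-top : rows λ′ ≡ count gap? L ∷ map (count gap?) (partsBelow L)
  rows-top = trans rows≡ (cong (map (count gap?)) (filter-accept part? L∈λ))

  length-partsBelow : length (partsBelow (suc L)) ≡ length λ′
  length-partsBelow = trans (cong length (sym reverse-λ≡partsBelow)) (length-reverse λ′)

  ≤length-partsBelow : ∀ {i} → i ≤ length λ′ → i ≤ length (partsBelow (suc L))
  ≤length-partsBelow = subst (_ ≤_) (sym length-partsBelow)

  length-λ : length λ′ ≡ count part? (suc L)
  length-λ = trans (sym length-partsBelow) (length-filter-downFrom part? (suc L))

  numRows≡length : numRows λ′ ≡ length λ′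
  numRows≡length = trans (length-map (rowLength λ′) (reverse λ′)) (length-reverse λ′)

  ith-part-∈ : ∀ i → suc i ≤ length λ′ → at (reverse λ′) (suc i) ∈ λ′
  ith-part-∈ i i<len = Any.reverse⁻ (at-∈ (reverse λ′) i (subst (suc i ≤_) (sym (length-reverse λ′)) i<len))

  drop-partsBelow : ∀ i → suc i ≤ length λ′ →
    drop (suc i) (partsBelow (suc L)) ≡ partsBelow (at (reverse λ′) (suc i))
  drop-partsBelow i i<len = begin
    drop (suc i) (partsBelow (suc L))                ≡⟨ drop-filter-downFrom part? (suc L) i (≤length-partsBelow i<len) ⟩
    partsBelow (at (partsBelow (suc L)) (suc i))     ≡⟨ cong (λ xs → partsBelow (at xs (suc i))) reverse-λ≡partsBelow ⟨
    partsBelow (at (reverse λ′) (suc i))             ∎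
    where open ≡-Reasoning

  at-rows : ∀ i → suc i ≤ length λ′ → at (rows λ′) (suc i) ≡ count gap? (at (reverse λ′) (suc i))
  at-rows i i<len = begin
    at (rows λ′) (suc i)                               ≡⟨ cong (λ R → at R (suc i)) rows≡ ⟩
    at (map (count gap?) (partsBelow (suc L))) (suc i) ≡⟨ at-map (count gap?) (partsBelow (suc L)) i (≤length-partsBelow i<len) ⟩
    count gap? (at (partsBelow (suc L)) (suc i))       ≡⟨ cong (λ xs → count gap? (at xs (suc i))) reverse-λ≡partsBelow ⟨
    count gap? (at (reverse λ′) (suc i))               ∎
    where open ≡-Reasoning

  parts-below-ith : ∀ i → suc i ≤ length λ′ → count part? (at (reverse λ′) (suc i)) + suc i ≡ length λ′
  parts-below-ith i i<len = begin
    count part? g + suc i                           ≡⟨ cong (_+ suc i) (length-filter-downFrom part? g) ⟨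
    length (partsBelow g) + suc i                   ≡⟨ cong (λ xs → length xs + suc i) (drop-partsBelow i i<len) ⟨
    length (drop (suc i) D) + suc i                 ≡⟨ cong (_+ suc i) (length-drop (suc i) D) ⟩
    length D ∸ suc i + suc i                        ≡⟨ m∸n+n≡m (≤length-partsBelow i<len) ⟩
    length D                                        ≡⟨ length-partsBelow ⟩
    length λ′                                       ∎
    where
    open ≡-Reasoning
    g = at (reverse λ′) (suc i)
    D = partsBelow (suc L)

  hook-first-column : ∀ i → suc i ≤ length λ′ → hook λ′ (suc i) 1 ≡ at (reverse λ′) (suc i)
  hook-first-column i i<len = begin
    hook λ′ (suc i) 1                                              ≡⟨ cong₂ (λ a b → (a ∸ 1) + b + 1) (at-rows i i<len) leg ⟩
    (nc g ∸ 1) + count part? g + 1                                 ≡⟨ cong (_+ 1) (+-∸-comm (count part? g) 1≤nc) ⟨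
    (nc g + count part? g) ∸ 1 + 1                                 ≡⟨ m∸n+n≡m (≤-trans 1≤nc (m≤m+n _ _)) ⟩
    nc g + count part? g                                           ≡⟨ +-comm (nc g) _ ⟩
    count part? g + nc g                                           ≡⟨ count-complement part? g ⟩
    g                                                              ∎
    where
    open ≡-Reasoning
    nc = count gap?
    D = partsBelow (suc L)
    g = at (reverse λ′) (suc i)
    1≤nc : 1 ≤ nc g
    1≤nc = gaps-below-part (ith-part-∈ i i<len)
    lower-rows-nonempty : All (1 ≤_) (map nc (partsBelow g))
    lower-rows-nonempty = All.map⁺ (All.tabulate (λ p∈ →
      gaps-below-part (proj₂ (∈-filter⁻ part? {xs = downFrom g} p∈))))
    lower-rows : drop (suc i) (map nc D) ≡ map nc (partsBelow g)
    lower-rows = trans (drop-map (suc i) D) (cong (map nc) (drop-partsBelow i i<len))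
    leg : length (filter (1 ≤?_) (drop (suc i) (rows λ′))) ≡ count part? g
    leg = begin
      length (filter (1 ≤?_) (drop (suc i) (rows λ′)))   ≡⟨ cong (length ∘′ filter (1 ≤?_) ∘′ drop (suc i)) rows≡ ⟩
      length (filter (1 ≤?_) (drop (suc i) (map nc D)))  ≡⟨ cong (length ∘′ filter (1 ≤?_)) lower-rows ⟩
      length (filter (1 ≤?_) (map nc (partsBelow g)))     ≡⟨ cong length (filter-all (1 ≤?_) lower-rows-nonempty) ⟩
      length (map nc (partsBelow g))                      ≡⟨ length-map nc (partsBelow g) ⟩
      length (partsBelow g)                               ≡⟨ length-filter-downFrom part? g ⟩
      count part? g                                       ∎

  -- Columns are labelled by the gaps below L; the gap s labels column count gap? (suc s).
  hook-first-row : ∀ {s} → s < L → s ∉ λ′ → hook λ′ 1 (count gap? (suc s)) ≡ L ∸ s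
  hook-first-row {s} s<L s∉λ = begin
    hook λ′ 1 j
      ≡⟨ cong (λ R → (at R 1 ∸ j) + length (filter (j ≤?_) (drop 1 R)) + 1) rows-top ⟩
    (nc L ∸ j) + length (filter (j ≤?_) (map nc (partsBelow L))) + 1 ≡⟨ cong (λ b → (nc L ∸ j) + b + 1) leg≡ ⟩
    arm + leg + 1                                                     ≡⟨ m+n∸n≡m (arm + leg + 1) s ⟨
    arm + leg + 1 + s ∸ s                                             ≡⟨ cong (_∸ s) total ⟩
    L ∸ s                                                             ∎
    where
    open ≡-Reasoning
    nc = count gap?
    c = count part?
    j = nc (suc s)
    arm = nc L ∸ j
    leg = length (filter (suc s ≤?_) (partsBelow L))
    reaches? : Decidable (λ p → j ≤ nc p)
    reaches? p = j ≤? nc p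
    threshold : (λ p → j ≤ nc p) ≐ (suc s ≤_)
    threshold = count-threshold gap? s∉λ , count-mono gap?
    leg≡ : length (filter (j ≤?_) (map nc (partsBelow L))) ≡ leg
    leg≡ = begin
      length (filter (j ≤?_) (map nc (partsBelow L)))                ≡⟨ cong length (filter-map (j ≤?_) nc (partsBelow L)) ⟩
      length (map nc (filter reaches? (partsBelow L)))               ≡⟨ length-map nc (filter reaches? (partsBelow L)) ⟩
      length (filter reaches? (partsBelow L))                        ≡⟨ cong length (filter-≐ reaches? (suc s ≤?_) threshold (partsBelow L)) ⟩
      leg                                                            ∎
    total : arm + leg + 1 + s ≡ L
    total = begin
      arm + leg + 1 + s               ≡⟨ +-assoc (arm + leg) 1 s ⟩
      arm + leg + suc s               ≡⟨ cong (arm + leg +_) (trans (sym (count-complement part? (suc s))) (+-comm (c (suc s)) j)) ⟩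
      arm + leg + (j + c (suc s))     ≡⟨ interchange arm leg j (c (suc s)) ⟩
      (arm + j) + (leg + c (suc s))   ≡⟨ cong₂ _+_ (m∸n+n≡m (count-mono gap? s<L)) (length-filter-≤-downFrom part? s<L) ⟩
      nc L + c L                      ≡⟨ +-comm (nc L) (c L) ⟩
      c L + nc L                      ≡⟨ count-complement part? L ⟩
      L                               ∎

module SymmetricDiagram (λ′ : List ℕ) (m : ℕ) (partition : IsDistinctPartition λ′)
                        (unrefinable : Unrefinable λ′) (largest≡ : largest λ′ ≡ suc (2 * m))
                        (#missing : length (missing λ′) ≡ m) where

  L : ℕ
  L = suc (2 * m)

  L∈λ : L ∈ λ′
  L∈λ = subst (_∈ λ′) largest≡ (largest-∈ λ′ (subst (0 <_) (sym largest≡) z<s))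

  bounded : All (_≤ L) λ′
  bounded = All.tabulate (λ z∈λ → subst (_ ≤_) largest≡ (∈⇒≤-largest z∈λ))

  open Diagram λ′ L (proj₁ partition) (proj₁ (proj₂ partition)) bounded L∈λ

  gaps-up-to-L : count gap? (suc L) ≡ suc m
  gaps-up-to-L = begin
    count gap? (suc L)                               ≡⟨ length-filter-upTo gap? (suc L) ⟨
    length (filter gap? (0 ∷ applyUpTo suc L))       ≡⟨ cong length (filter-accept gap? 0∉λ) ⟩
    suc (length (filter gap? (applyUpTo suc L)))     ≡⟨ cong (suc ∘′ length ∘′ filter gap?) (map-upTo suc L) ⟨
    suc (length (filter gap? (map suc (upTo L))))    ≡⟨ cong (λ l → suc (length (filter gap? (map suc (upTo l))))) largest≡ ⟨
    suc (length (missing λ′))                        ≡⟨ cong suc #missing ⟩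
    suc m                                            ∎
    where open ≡-Reasoning

  parts-up-to-L : count part? (suc L) ≡ suc m
  parts-up-to-L = +-cancelʳ-≡ _ _ _ (begin
    count part? (suc L) + suc m               ≡⟨ cong (count part? (suc L) +_) gaps-up-to-L ⟨
    count part? (suc L) + count gap? (suc L)  ≡⟨ count-complement part? (suc L) ⟩
    suc L                                     ≡⟨ *-suc 2 m ⟨
    2 * suc m                                 ≡⟨ cong (suc m +_) (+-identityʳ (suc m)) ⟩
    suc m + suc m                             ∎)
    where open ≡-Reasoning

  ∈-missing⁺ : ∀ {y} → y ∉ λ′ → 0 < y → y ≤ L → y ∈ missing λ′
  ∈-missing⁺ {suc y} y∉λ _ y<L =
    ∈-filter⁺ gap? (∈-map⁺ suc (∈-upTo⁺ (subst (y <_) (sym largest≡) y<L))) y∉λ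

  reflection-cover : ∀ x → x ≤ L → x ∈ λ′ ⊎ L ∸ x ∈ λ′
  reflection-cover zero    _   = inj₂ L∈λ
  reflection-cover x@(suc _) x≤L with x ∈? λ′ | (L ∸ x) ∈? λ′
  ... | yes x∈λ | _         = inj₁ x∈λ
  ... | no  _   | yes x′∈λ  = inj₂ x′∈λ
  ... | no  x∉λ | no  x′∉λ  = ⊥-elim (unrefinable x (L ∸ x)
          (∈-missing⁺ x∉λ z<s x≤L) (∈-missing⁺ x′∉λ (m<n⇒0<n∸m x<L) (m∸n≤m L x)) x≢x′
          (subst (_∈ λ′) (sym (m+[n∸m]≡n x≤L)) L∈λ))
    where
    x<L : x < L
    x<L = ≤∧≢⇒< x≤L (λ { refl → x∉λ L∈λ })
    x≢x′ : x ≢ L ∸ x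
    x≢x′ x≡x′ = even≢odd x m (begin
      2 * x        ≡⟨ cong (x +_) (+-identityʳ x) ⟩
      x + x        ≡⟨ cong (x +_) x≡x′ ⟩
      x + (L ∸ x)  ≡⟨ m+[n∸m]≡n x≤L ⟩
      L            ∎)
      where open ≡-Reasoning

  symmetric : ∀ {x} → x ≤ L → x ∈ λ′ → L ∸ x ∉ λ′
  symmetric = reflection-matching part? L reflection-cover (trans (cong (2 *_) parts-up-to-L) (*-suc 2 m))

  gaps-reflect : ∀ a → a ≤ suc L → count gap? a + count part? (suc L ∸ a) ≡ count part? (suc L)
  gaps-reflect a a≤1+L = trans
    (cong (_+ count part? (suc L ∸ a)) (count-cong gap? (λ x → part? (L ∸ x)) a gap⇔reflected-part))
    (count-reflect part? L a a≤1+L)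
    where
    gap⇔reflected-part : ∀ x → x < a → (x ∉ λ′ → L ∸ x ∈ λ′) × (L ∸ x ∈ λ′ → x ∉ λ′)
    gap⇔reflected-part x x<a = [ contradiction , const ]′ (reflection-cover x x≤L)
                             , λ x′∈λ x∈λ → symmetric x≤L x∈λ x′∈λ
      where x≤L = ≤-pred (≤-trans x<a a≤1+L)

  module _ (i : ℕ) (i≤m : i ≤ m) where

    private
      i<len : suc i ≤ length λ′
      i<len = subst (suc i ≤_) (sym (trans length-λ parts-up-to-L)) (s≤s i≤m)

      g = at (reverse λ′) (suc i)

      g∈λ : g ∈ λ′
      g∈λ = ith-part-∈ i i<len

      g≤L : g ≤ L
      g≤L = All.lookup bounded g∈λ

      L∸g<L : L ∸ g < L
      L∸g<L = ∸-monoʳ-< (All.lookup (proj₁ (proj₂ partition)) g∈λ) g≤L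

    column-of-reflected-part : count gap? (suc (L ∸ g)) ≡ suc i
    column-of-reflected-part = +-cancelʳ-≡ (count part? g) _ _ (begin
      count gap? (suc (L ∸ g)) + count part? g                ≡⟨ cong (λ y → count gap? (suc (L ∸ g)) + count part? y) (m∸[m∸n]≡n g≤L) ⟨
      count gap? (suc (L ∸ g)) + count part? (L ∸ (L ∸ g))    ≡⟨ gaps-reflect (suc (L ∸ g)) (s≤s (m∸n≤m L g)) ⟩
      count part? (suc L)                                     ≡⟨ trans (parts-below-ith i i<len) length-λ ⟨
      count part? g + suc i                                   ≡⟨ +-comm (count part? g) (suc i) ⟩
      suc i + count part? g                                   ∎)
      where open ≡-Reasoning

    hooks-agree : hook λ′ (suc i) 1 ≡ hook λ′ 1 (suc i)
    hooks-agree = begin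
      hook λ′ (suc i) 1                       ≡⟨ hook-first-column i i<len ⟩
      g                                       ≡⟨ m∸[m∸n]≡n g≤L ⟨
      L ∸ (L ∸ g)                             ≡⟨ hook-first-row L∸g<L (symmetric g≤L g∈λ) ⟨
      hook λ′ 1 (count gap? (suc (L ∸ g)))    ≡⟨ cong (hook λ′ 1) column-of-reflected-part ⟩
      hook λ′ 1 (suc i)                       ∎
      where open ≡-Reasoning

    first-column-cell : IsCell λ′ (suc i) 1
    first-column-cell = s≤s z≤n , subst (suc i ≤_) (sym numRows≡length) i<len , ≤-refl
                      , subst (1 ≤_) (sym (at-rows i i<len)) (gaps-below-part g∈λ)

    first-row-cell : IsCell λ′ 1 (suc i)
    first-row-cell = ≤-refl , subst (1 ≤_) (sym numRows≡length) (≤-trans (s≤s z≤n) i<len) , s≤s z≤n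
                   , subst (suc i ≤_) (sym first-row-length) (s≤s i≤m)
      where
      first-row-length : at (rows λ′) 1 ≡ suc m
      first-row-length = trans (cong (λ R → at R 1) rows-top)
                               (trans (sym (count-suc-reject gap? (λ L∉λ → L∉λ L∈λ))) gaps-up-to-L)

half-of-odd : ∀ m → suc (2 * m) / 2 ≡ m
half-of-odd m = begin
  suc (2 * m) / 2       ≡⟨ cong (λ x → suc x / 2) (*-comm 2 m) ⟩
  (1 + m * 2) / 2       ≡⟨ +-distrib-/-∣ʳ 1 {d = 2} (divides-refl m) ⟩
  1 / 2 + m * 2 / 2     ≡⟨ m*n/n≡m m 2 ⟩
  m                     ∎
  where open ≡-Reasoning

lemma4p3 : (n k : ℕ) → 2 ≤ 2 * k → 2 * k + 4 ≤ n →
    (λ′ : List ℕ) → UBar (T₂ n (n ∸ 2 * k)) λ′ → largest λ′ ≡ 2 * n ∸ 5 →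
    (i : ℕ) → 1 ≤ i → i ≤ n ∸ 2 →
      IsCell λ′ i 1 × IsCell λ′ 1 i × hook λ′ i 1 ≡ hook λ′ 1 i
lemma4p3 n k _ 2k+4≤n λ′ (((partition , _ , unrefinable) , _) , #missing) largest≡ (suc i) _ 1+i≤n∸2 =
  first-column-cell i i≤m , first-row-cell i i≤m , hooks-agree i i≤m
  where
  m = n ∸ 3
  n≡3+m : n ≡ 3 + m
  n≡3+m = sym (m+[n∸m]≡n (≤-trans (n≤1+n 3) (≤-trans (m≤n+m 4 (2 * k)) 2k+4≤n)))
  largest≡2m+1 : largest λ′ ≡ suc (2 * m)
  largest≡2m+1 = trans largest≡ (trans (cong (λ x → 2 * x ∸ 5) n≡3+m) (cong (_∸ 5) (*-distribˡ-+ 2 3 m)))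
  open SymmetricDiagram λ′ m partition unrefinable largest≡2m+1
         (trans #missing (trans (cong (_/ 2) largest≡2m+1) (half-of-odd m)))
  i≤m : i ≤ m
  i≤m = ≤-pred (subst (λ x → suc i ≤ x ∸ 2) n≡3+m 1+i≤n∸2)
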